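{- Let $g\in s\mathcal{B}_n$ with $\mathrm{per}(g)=b>1$. Then for all $i,j\in[0,n-b+1]$ with $i\not\equiv j\pmod b$, we have $\mathrm{Spec}\,g|_{[i,i+b-1]}\ne \mathrm{Spec}\,g|_{[j,j+b-1]}$.
   Context: $s\mathcal{B}_n$ is the set of symmetric Boolean functions on $n$ variables; each $g\in s\mathcal{B}_n$ has a spectrum $\mathrm{Spec}\,g:[0,n]\to\{0,1\}$ with $g(a)=\mathrm{Spec}\,g(|a|)$ ($|a|$ = Hamming weight). $\mathrm{per}(g)$ is the smallest positive integer $b$ with $\mathrm{Spec}\,g(i)=\mathrm{Spec}\,g(i+b)$ for all $i\in[0,n-b]$. For an integer interval $J$, $\mathrm{Spec}\,g|_J$ denotes the restriction, viewed as a binary string. -}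

module Defs where

open import Data.Nat using (ℕ; zero; suc; _+_; _∸_; _≤_; _<_; _<?_)
open import Data.Nat.Properties using (≤-refl)
open import Data.Bool using (Bool; false)
open import Data.Fin using (Fin; fromℕ<)
open import Data.Vec using (Vec; count; tabulate)
open import Data.Fin using (toℕ)
open import Data.Bool using (T)
open import Relation.Nullary using (¬_; yes; no)
open import Relation.Nullary.Decidable using (does)
open import Relation.Binary.PropositionalEquality using (_≡_)
open import Data.Bool.Properties using (T?)

∣_∣ₕ : ∀ {n} → Vec Bool n → ℕ
∣ a ∣ₕ = count T? a

weight<1+n : ∀ {n} (a : Vec Bool n) → ∣ a ∣ₕ < suc n
weight<1+n {n} a = Data.Nat.s≤s (Data.Vec.Properties.count≤n T? a)
  where import Data.Nat ; import Data.Vec.Properties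

record SymBool (n : ℕ) : Set where
  field
    fun  : Vec Bool n → Bool
    Spec : Fin (suc n) → Bool
    spec-correct : ∀ (a : Vec Bool n) → fun a ≡ Spec (fromℕ< (weight<1+n a))
open SymBool public

-- spectrum indexed by naturals (meaningful on [0,n]; false outside, never used there)
specℕ : ∀ {n} → SymBool n → ℕ → Bool
specℕ {n} g i with i <? suc n
... | yes p = Spec g (fromℕ< p)
... | no _  = false

IsPeriod : ∀ {n} → SymBool n → ℕ → Set
IsPeriod {n} g b = 1 ≤ b × (∀ i → i + b ≤ n → specℕ g i ≡ specℕ g (i + b))
  where open import Data.Product using (_×_)

Per : ∀ {n} → SymBool n → ℕ → Set
Per g b = IsPeriod g b × (∀ c → 1 ≤ c → c < b → ¬ IsPeriod g c)
  where open import Data.Product using (_×_)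

restrict : ∀ {n} → SymBool n → (i b : ℕ) → Vec Bool b
restrict g i b = tabulate (λ (k : Fin b) → specℕ g (i + toℕ k))

open import Data.Nat using (_*_)
open import Data.Sum using (_⊎_)
open import Data.Product using (∃)
_≡_[mod_] : ℕ → ℕ → ℕ → Set
i ≡ j [mod b ] = ∃ (λ k → i ≡ j + k * b) ⊎ ∃ (λ k → j ≡ i + k * b)

module Submission where

-- Write s for the spectrum of g and suppose two length-b
-- windows of s, starting at i < j = i + d with d ≢ 0 (mod b), coincide.
-- Since b is a period of s on [0,n], s is the restriction of the genuinely
-- b-periodic sequence  ext m = s (m % b)  on all of ℕ.  A b-periodic sequence
-- whose windows at i and i + d agree satisfies ext (m + d) = ext m for every m,
-- hence also has the period  r = d % b,  and restricting back to [0,n] shows that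
-- r is a period of s with 1 ≤ r < b, contradicting the minimality of b.  The
-- degenerate case b = n + 1 (where the window at j sticks out of [0,n]) forces
-- i = 0, j = 1, and the two windows then directly say that 1 is a period.

open import Defs
open import Data.Nat using (ℕ; zero; suc; _+_; _*_; _∸_; _≤_; _<_; z≤n; s≤s; s≤s⁻¹; NonZero; _%_; _/_)
open import Data.Nat.Properties
open import Data.Nat.DivMod using (m≡m%n+[m/n]*n; [m+n]%n≡m%n; m%n<n)
open import Data.Nat.Solver using (module +-*-Solver)
open import Data.Vec using (lookup)
open import Data.Vec.Properties using (lookup∘tabulate)
open import Data.Fin using (Fin; toℕ; fromℕ<)
open import Data.Fin.Properties using (toℕ-fromℕ<)
open import Data.Product using (_,_; ∃)
open import Data.Sum using (inj₁; inj₂)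
open import Data.Empty using (⊥-elim)
open import Relation.Nullary using (¬_; yes; no)
open import Relation.Binary using (tri<; tri≈; tri>)
open import Relation.Binary.PropositionalEquality
  using (_≡_; _≢_; refl; sym; trans; cong; subst; module ≡-Reasoning)

open +-*-Solver using (solve; _:+_; _:*_; _:=_; con)

module Sequences {A : Set} where

  Periodic : (ℕ → A) → ℕ → Set
  Periodic f p = ∀ m → f (m + p) ≡ f m

  PeriodOn : ℕ → (ℕ → A) → ℕ → Set
  PeriodOn n s p = ∀ i → i + p ≤ n → s i ≡ s (i + p)

  module _ {f : ℕ → A} {p : ℕ} (per : Periodic f p) where

    periodic-* : ∀ m q → f (m + q * p) ≡ f m
    periodic-* m zero    = cong f (+-identityʳ m)
    periodic-* m (suc q) = begin
      f (m + (p + q * p))  ≡⟨ cong f (trans (cong (m +_) (+-comm p (q * p))) (sym (+-assoc m (q * p) p))) ⟩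
      f (m + q * p + p)    ≡⟨ per (m + q * p) ⟩
      f (m + q * p)        ≡⟨ periodic-* m q ⟩
      f m                  ∎
      where open ≡-Reasoning

    periodic-% : .{{_ : NonZero p}} → ∀ m x → f (m + x) ≡ f (m + x % p)
    periodic-% m x = begin
      f (m + x)                    ≡⟨ cong (λ t → f (m + t)) (m≡m%n+[m/n]*n x p) ⟩
      f (m + (x % p + x / p * p))  ≡⟨ cong f (sym (+-assoc m (x % p) (x / p * p))) ⟩
      f (m + x % p + x / p * p)    ≡⟨ periodic-* (m + x % p) (x / p) ⟩
      f (m + x % p)                ∎
      where open ≡-Reasoning

    window-spreads : .{{_ : NonZero p}} → ∀ i j → (∀ k → k < p → f (i + k) ≡ f (j + k)) →
                     ∀ m → f (i + m) ≡ f (j + m)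
    window-spreads i j window m = begin
      f (i + m)      ≡⟨ periodic-% i m ⟩
      f (i + m % p)  ≡⟨ window (m % p) (m%n<n m p) ⟩
      f (j + m % p)  ≡⟨ periodic-% j m ⟨
      f (j + m)      ∎
      where open ≡-Reasoning

  -- If the tails of a periodic sequence from i and i + d agree, d is a period
  -- (every position is moved beyond i by adding a multiple of the period).
  translation-period : ∀ {f : ℕ → A} {p} → Periodic f (suc p) → ∀ i d →
                       (∀ m → f (i + m) ≡ f (i + d + m)) → Periodic f d
  translation-period {f} {p} per i d tails x = begin
    f (x + d)                  ≡⟨ periodic-* per (x + d) i ⟨
    f (x + d + i * suc p)      ≡⟨ cong f (solve 4 (λ x d i p → x :+ d :+ i :* (con 1 :+ p)
                                   := i :+ d :+ (x :+ i :* p)) refl x d i p) ⟩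
    f (i + d + (x + i * p))    ≡⟨ tails (x + i * p) ⟨
    f (i + (x + i * p))        ≡⟨ cong f (solve 3 (λ x i p → i :+ (x :+ i :* p)
                                   := x :+ i :* (con 1 :+ p)) refl x i p) ⟩
    f (x + i * suc p)          ≡⟨ periodic-* per x i ⟩
    f x                        ∎
    where open ≡-Reasoning

  period-% : ∀ {f : ℕ → A} {p d} .{{_ : NonZero p}} → Periodic f p → Periodic f d →
             Periodic f (d % p)
  period-% {f} {p} {d} perp perd m = begin
    f (m + d % p)                ≡⟨ periodic-* perp (m + d % p) (d / p) ⟨
    f (m + d % p + d / p * p)    ≡⟨ cong f (trans (+-assoc m (d % p) (d / p * p))
                                      (cong (m +_) (sym (m≡m%n+[m/n]*n d p)))) ⟩
    f (m + d)                    ≡⟨ perd m ⟩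
    f m                          ∎
    where open ≡-Reasoning

  periodOn-* : ∀ {n s p} → PeriodOn n s p → ∀ y q → y + q * p ≤ n → s (y + q * p) ≡ s y
  periodOn-* {n} {s} {p} per y zero    _ = cong s (+-identityʳ y)
  periodOn-* {n} {s} {p} per y (suc q) h = begin
    s (y + suc q * p)  ≡⟨ cong s shuffle ⟩
    s (y + q * p + p)  ≡⟨ per (y + q * p) h′ ⟨
    s (y + q * p)      ≡⟨ periodOn-* per y q (≤-trans (m≤m+n (y + q * p) p) h′) ⟩
    s y                ∎
    where
      open ≡-Reasoning
      shuffle : y + suc q * p ≡ y + q * p + p
      shuffle = solve 3 (λ y q p → y :+ (con 1 :+ q) :* p := y :+ q :* p :+ p) refl y q p
      h′ : y + q * p + p ≤ n
      h′ = subst (_≤ n) shuffle h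

  period-restricts : ∀ {n s f r} → (∀ m → m ≤ n → f m ≡ s m) → Periodic f r → PeriodOn n s r
  period-restricts {n} {s} {f} {r} agree per m h = begin
    s m        ≡⟨ agree m (≤-trans (m≤m+n m r) h) ⟨
    f m        ≡⟨ per m ⟨
    f (m + r)  ≡⟨ agree (m + r) h ⟩
    s (m + r)  ∎
    where open ≡-Reasoning

  module Extension {n : ℕ} {s : ℕ → A} {p : ℕ} .{{_ : NonZero p}} (per : PeriodOn n s p) where

    ext : ℕ → A
    ext m = s (m % p)

    ext-periodic : Periodic ext p
    ext-periodic m = cong s ([m+n]%n≡m%n m p)

    ext-agrees : ∀ m → m ≤ n → ext m ≡ s m
    ext-agrees m h = sym (trans (cong s split) (periodOn-* per (m % p) (m / p) (subst (_≤ n) split h)))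
      where split = m≡m%n+[m/n]*n m p

  in-window : ∀ {n p} j k → j + p ≤ suc n → k < p → j + k ≤ n
  in-window {n} {p} j k fits k<p = s≤s⁻¹ (≤-trans (≤-reflexive (sym (+-suc j k)))
                                      (≤-trans (+-monoʳ-≤ j k<p) fits))

  shifted-window-period : ∀ {n s c} → let p = suc c in PeriodOn n s p → ∀ i d →
    i + d + p ≤ suc n → (∀ k → k < p → s (i + k) ≡ s (i + d + k)) → PeriodOn n s (d % p)
  shifted-window-period {n} {s} {c} per i d fits window =
    period-restricts ext-agrees
      (period-% ext-periodic
        (translation-period ext-periodic i d (window-spreads ext-periodic i (i + d) extWindow)))
    where
      open Extension per
      fits-i : i + suc c ≤ suc n
      fits-i = ≤-trans (+-monoˡ-≤ (suc c) (m≤m+n i d)) fits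
      extWindow : ∀ k → k < suc c → ext (i + k) ≡ ext (i + d + k)
      extWindow k k<p = begin
        ext (i + k)      ≡⟨ ext-agrees (i + k) (in-window i k fits-i k<p) ⟩
        s (i + k)        ≡⟨ window k k<p ⟩
        s (i + d + k)    ≡⟨ ext-agrees (i + d + k) (in-window (i + d) k fits k<p) ⟨
        ext (i + d + k)  ∎
        where open ≡-Reasoning

open Sequences

restrict-pointwise : ∀ {n} {g : SymBool n} {b} i j → restrict g i b ≡ restrict g j b →
                     ∀ k → k < b → specℕ g (i + k) ≡ specℕ g (j + k)
restrict-pointwise {n} {g} {b} i j eq k k<b = begin
  specℕ g (i + k)                   ≡⟨ cong (λ t → specℕ g (i + t)) (toℕ-fromℕ< k<b) ⟨
  specℕ g (i + toℕ (fromℕ< k<b))    ≡⟨ lookup∘tabulate (λ (l : Fin b) → specℕ g (i + toℕ l)) (fromℕ< k<b) ⟨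
  lookup (restrict g i b) (fromℕ< k<b)  ≡⟨ cong (λ v → lookup v (fromℕ< k<b)) eq ⟩
  lookup (restrict g j b) (fromℕ< k<b)  ≡⟨ lookup∘tabulate (λ (l : Fin b) → specℕ g (j + toℕ l)) (fromℕ< k<b) ⟩
  specℕ g (j + toℕ (fromℕ< k<b))    ≡⟨ cong (λ t → specℕ g (j + t)) (toℕ-fromℕ< k<b) ⟩
  specℕ g (j + k)                   ∎
  where open ≡-Reasoning

-- per(g) ≤ n + 1, since n + 1 is (vacuously) a period of every spectrum.
per≤1+n : ∀ {n} {g : SymBool n} {b} → Per g b → b ≤ suc n
per≤1+n {n} {g} {b} (_ , minimal) with b ≤? suc n
... | yes b≤1+n = b≤1+n
... | no  b≰1+n = ⊥-elim (minimal (suc n) (s≤s z≤n) (≰⇒> b≰1+n) (s≤s z≤n , vacuous))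
  where
    vacuous : PeriodOn n (specℕ g) (suc n)
    vacuous i i+1+n≤n = ⊥-elim (<⇒≱ (s≤s (m≤n+m n i)) (subst (_≤ n) (+-suc i n) i+1+n≤n))

window-fits : ∀ {n b j} → b ≤ n → j ≤ n ∸ b + 1 → j + b ≤ suc n
window-fits {n} {b} {j} b≤n j≤ = begin
  j + b            ≤⟨ +-monoˡ-≤ b j≤ ⟩
  n ∸ b + 1 + b    ≡⟨ solve 2 (λ x b → x :+ con 1 :+ b := con 1 :+ (x :+ b)) refl (n ∸ b) b ⟩
  suc (n ∸ b + b)  ≡⟨ cong suc (m∸n+n≡m b≤n) ⟩
  suc n            ∎
  where open ≤-Reasoning

distinct-windows< : ∀ {n} (g : SymBool n) b → Per g b → 1 < b → ∀ i j → i < j →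
  j ≤ n ∸ b + 1 → ¬ (∃ λ q → j ≡ i + q * b) →
  ¬ (∀ k → k < b → specℕ g (i + k) ≡ specℕ g (j + k))
distinct-windows< {n} g b@(suc (suc c)) per@((_ , periodOnB) , minimal) (s≤s (s≤s z≤n)) i j i<j j≤ noncongruent window
  with m≤n⇒m<n∨m≡n (per≤1+n per)
... | inj₁ b<1+n = minimal r 1≤r (m%n<n d b) (1≤r , shifted-window-period periodOnB i d fits window′)
  where
    d = j ∸ i
    r = d % b
    i+d≡j : i + d ≡ j
    i+d≡j = m+[n∸m]≡n (<⇒≤ i<j)
    fits : i + d + b ≤ suc n
    fits = subst (λ t → t + b ≤ suc n) (sym i+d≡j) (window-fits (s≤s⁻¹ b<1+n) j≤)
    window′ : ∀ k → k < b → specℕ g (i + k) ≡ specℕ g (i + d + k)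
    window′ k k<b = trans (window k k<b) (cong (λ t → specℕ g (t + k)) (sym i+d≡j))
    -- r = 0 would make j ≡ i (mod b)
    1≤r : 1 ≤ r
    1≤r = n≢0⇒n>0 λ r≡0 → noncongruent (d / b , trans (sym i+d≡j) (cong (i +_)
            (trans (m≡m%n+[m/n]*n d b) (cong (_+ d / b * b) r≡0))))
... | inj₂ b≡1+n = minimal 1 (s≤s z≤n) (s≤s (s≤s z≤n)) (s≤s z≤n , period1)
  where
    -- here n - b + 1 = 1, so the windows start at i = 0 and j = 1
    j≤1 : j ≤ 1
    j≤1 = subst (λ t → j ≤ t + 1) (m≤n⇒m∸n≡0 (subst (n ≤_) (sym b≡1+n) (n≤1+n n))) j≤
    i≡0 : i ≡ 0
    i≡0 = n≤0⇒n≡0 (s≤s⁻¹ (≤-trans i<j j≤1))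
    j≡1 : j ≡ 1
    j≡1 = ≤-antisym j≤1 (subst (_< j) i≡0 i<j)
    period1 : PeriodOn n (specℕ g) 1
    period1 m m+1≤n = begin
      specℕ g m        ≡⟨ cong (λ t → specℕ g (t + m)) i≡0 ⟨
      specℕ g (i + m)  ≡⟨ window m (subst (m <_) (sym b≡1+n) (s≤s (≤-trans (m≤m+n m 1) m+1≤n))) ⟩
      specℕ g (j + m)  ≡⟨ cong (λ t → specℕ g (t + m)) j≡1 ⟩
      specℕ g (1 + m)  ≡⟨ cong (specℕ g) (+-comm 1 m) ⟩
      specℕ g (m + 1)  ∎
      where open ≡-Reasoning

corollary2p8 : ∀ (n : ℕ) (g : SymBool n) (b : ℕ) → Per g b → 1 < b →
    ∀ (i j : ℕ) → i ≤ n ∸ b + 1 → j ≤ n ∸ b + 1 →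
    ¬ (i ≡ j [mod b ]) → restrict g i b ≢ restrict g j b
corollary2p8 n g b per 1<b i j i≤ j≤ noncongruent eq with <-cmp i j
... | tri< i<j _ _ = distinct-windows< g b per 1<b i j i<j j≤
                       (λ c → noncongruent (inj₂ c)) (restrict-pointwise i j eq)
... | tri≈ _ refl _ = noncongruent (inj₁ (0 , sym (+-identityʳ i)))
... | tri> _ _ j<i = distinct-windows< g b per 1<b j i j<i i≤
                       (λ c → noncongruent (inj₁ c)) (restrict-pointwise j i (sym eq))
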